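{- The reduction $\to_\partial$, viewed as a binary relation on finite formal sums of resource expressions, is strongly normalizing: there is no infinite sequence $E_0\to_\partial E_1\to_\partial E_2\to_\partial\cdots$.
   Context: Resource terms and monomials: $s,t ::= x\mid\lambda x.s\mid\langle s\rangle\bar t\mid s\oplus\bullet\mid\bullet\oplus s$, $\bar t::=[t_1,\dots,t_n]$ (finite multisets of resource terms), up to $\alpha$-equivalence; a resource expression is a term or a monomial. Finite formal sums of resource terms (resp. of monomials) with coefficients in $\mathbb N$; constructors extended by multilinearity (so a constructor applied to $0$ gives $0$). For $\bar u=[u_1,\dots,u_n]$, $\partial_xe\cdot\bar u$ is defined by: $\partial_xy\cdot\bar u$ is $y$ if $y\ne x$ and $n=0$, $u_1$ if $y=x$ and $n=1$, $0$ otherwise; $\partial_x(\lambda y.s)\cdot\bar u=\lambda y.(\partial_xs\cdot\bar u)$ ($y$ fresh), $\partial_x(s\oplus\bullet)\cdot\bar u=(\partial_xs\cdot\bar u)\oplus\bullet$, $\partial_x(\bullet\oplus s)\cdot\bar u=\bullet\oplus(\partial_xs\cdot\bar u)$; $\partial_x(\langle s\rangle\bar t)\cdot\bar u=\sum_{(I_1,I_2)}\langle\partial_xs\cdot\bar u_{I_1}\rangle(\partial_x\bar t\cdot\bar u_{I_2})$; $\partial_x[t_1,\dots,t_k]\cdot\bar u=\sum_{(I_1,\dots,I_k)}[\partial_xt_1\cdot\bar u_{I_1},\dots,\partial_xt_k\cdot\bar u_{I_k}]$, sums over tuples of pairwise disjoint possibly empty subsets of $\{1,\dots,n\}$ covering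 it, $\bar u_I=[u_i\mid i\in I]$. The reduction $\to_\partial$ from resource expressions to finite sums is generated by $\langle\lambda x.s\rangle\bar t\to_\partial\partial_xs\cdot\bar t$, $\langle s\oplus\bullet\rangle\bar t\to_\partial(\langle s\rangle\bar t)\oplus\bullet$, $\langle\bullet\oplus s\rangle\bar t\to_\partial\bullet\oplus\langle s\rangle\bar t$, $\lambda x.(s\oplus\bullet)\to_\partial(\lambda x.s)\oplus\bullet$, $\lambda x.(\bullet\oplus s)\to_\partial\bullet\oplus\lambda x.s$, and the contextual rules: if $s\to_\partial S'$ then $\lambda x.s\to_\partial\lambda x.S'$, $\langle s\rangle\bar t\to_\partial\langle S'\rangle\bar t$, $s\oplus\bullet\to_\partial S'\oplus\bullet$, $\bullet\oplus s\to_\partial\bullet\oplus S'$, $[s]\cdot\bar t\to_\partial[S']\cdot\bar t$; if $\bar s\to_\partial\bar S'$ then $\langle t\rangle\bar s\to_\partial\langle t\rangle\bar S'$. It is extended to finite sums by $e+F\to_\partial E'+F$ whenever $e\to_\partial E'$. -}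

module Defs where

open import Data.Nat using (ℕ; zero; suc; _∸_; _<ᵇ_; _≡ᵇ_)
open import Data.Bool using (Bool; true; false; if_then_else_)
open import Data.List using (List; []; _∷_; _++_; map; concatMap)
open import Data.Product using (Σ; _×_; _,_; ∃)
open import Relation.Nullary using (¬_)

-- Resource terms, with de Bruijn indices (so terms are up to α).
-- A monomial (bag) [t₁,…,tₙ] is represented by a list; it is taken up to
-- permutation through the equivalence _≈_ below.

data Term : Set where
  var   : ℕ → Term
  lam   : Term → Term
  app   : Term → List Term → Term
  _⊕•   : Term → Term
  •⊕_   : Term → Term

Bag : Set
Bag = List Term

-- Finite formal sums with coefficients in ℕ = finite multisets,
-- represented by lists (taken up to permutation through _≈_ below).
-- The empty list is the sum 0.
Sum : Set → Set
Sum A = List A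

mutual
  shift : ℕ → Term → Term
  shift c (var y)   = if y <ᵇ c then var y else var (suc y)
  shift c (lam s)   = lam (shift (suc c) s)
  shift c (app s t) = app (shift c s) (shiftBag c t)
  shift c (s ⊕•)    = shift c s ⊕•
  shift c (•⊕ s)    = •⊕ shift c s

  shiftBag : ℕ → Bag → Bag
  shiftBag c []       = []
  shiftBag c (t ∷ ts) = shift c t ∷ shiftBag c ts

-- All ways of distributing the (indexed) elements of a list into two
-- lists, i.e. all pairs (ū_{I₁}, ū_{I₂}) for (I₁,I₂) a partition of the
-- index set into two disjoint, possibly empty, covering subsets.

splits : {A : Set} → List A → List (List A × List A)
splits []       = ([] , []) ∷ []
splits (u ∷ us) = concatMap (λ { (a , b) → (u ∷ a , b) ∷ (a , u ∷ b) ∷ [] }) (splits us)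

-- Linear substitution ∂_x e · ū, in de Bruijn form: x is an index; in
-- each nonzero summand x does not occur, so the variables above x are
-- lowered by one (the binder of x disappears).

mutual
  ∂ : ℕ → Term → List Term → Sum Term
  ∂ x (var y) [] =
    if y ≡ᵇ x then [] else (if y <ᵇ x then var y ∷ [] else var (y ∸ 1) ∷ [])
  ∂ x (var y) (u ∷ []) = if y ≡ᵇ x then u ∷ [] else []
  ∂ x (var y) (_ ∷ _ ∷ _) = []
  ∂ x (lam s) us = map lam (∂ (suc x) s (shiftBag 0 us))
  ∂ x (app s ts) us =
    concatMap (λ { (u₁ , u₂) →
      concatMap (λ s' → map (app s') (∂Bag x ts u₂)) (∂ x s u₁) }) (splits us)
  ∂ x (s ⊕•) us = map _⊕• (∂ x s us)
  ∂ x (•⊕ s) us = map •⊕_ (∂ x s us)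

  ∂Bag : ℕ → Bag → List Term → Sum Bag
  ∂Bag x [] [] = [] ∷ []
  ∂Bag x [] (_ ∷ _) = []
  ∂Bag x (t ∷ ts) us =
    concatMap (λ { (u₁ , u₂) →
      concatMap (λ t' → map (t' ∷_) (∂Bag x ts u₂)) (∂ x t u₁) }) (splits us)

data Sort : Set where
  tm mn : Sort

Expr : Sort → Set
Expr tm = Term
Expr mn = Bag

data PermR {A : Set} (R : A → A → Set) : List A → List A → Set where
  nil   : PermR R [] []
  cons  : ∀ {x y xs ys} → R x y → PermR R xs ys → PermR R (x ∷ xs) (y ∷ ys)
  swap  : ∀ {x y xs} → PermR R (x ∷ y ∷ xs) (y ∷ x ∷ xs)
  trans : ∀ {xs ys zs} → PermR R xs ys → PermR R ys zs → PermR R xs zs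

data _≈t_ : Term → Term → Set where
  var≈ : ∀ {y} → var y ≈t var y
  lam≈ : ∀ {s s'} → s ≈t s' → lam s ≈t lam s'
  app≈ : ∀ {s s' t t'} → s ≈t s' → PermR _≈t_ t t' → app s t ≈t app s' t'
  l⊕≈  : ∀ {s s'} → s ≈t s' → (s ⊕•) ≈t (s' ⊕•)
  r⊕≈  : ∀ {s s'} → s ≈t s' → (•⊕ s) ≈t (•⊕ s')

_≈E_ : {σ : Sort} → Expr σ → Expr σ → Set
_≈E_ {tm} = _≈t_
_≈E_ {mn} = PermR _≈t_

_≈_ : {σ : Sort} → Sum (Expr σ) → Sum (Expr σ) → Set
_≈_ {σ} = PermR (_≈E_ {σ})

mutual
  data _⇝t_ : Term → Sum Term → Set where
    β     : ∀ {s t} → app (lam s) t ⇝t ∂ 0 s t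
    app⊕• : ∀ {s t} → app (s ⊕•) t ⇝t ((app s t ⊕•) ∷ [])
    app•⊕ : ∀ {s t} → app (•⊕ s) t ⇝t ((•⊕ app s t) ∷ [])
    lam⊕• : ∀ {s} → lam (s ⊕•) ⇝t ((lam s ⊕•) ∷ [])
    lam•⊕ : ∀ {s} → lam (•⊕ s) ⇝t ((•⊕ lam s) ∷ [])
    ctx-lam : ∀ {s S'} → s ⇝t S' → lam s ⇝t map lam S'
    ctx-appˡ : ∀ {s S' t} → s ⇝t S' → app s t ⇝t map (λ s' → app s' t) S'
    ctx-⊕• : ∀ {s S'} → s ⇝t S' → (s ⊕•) ⇝t map _⊕• S'
    ctx-•⊕ : ∀ {s S'} → s ⇝t S' → (•⊕ s) ⇝t map •⊕_ S'
    ctx-appʳ : ∀ {s t T'} → t ⇝b T' → app s t ⇝t map (app s) T'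

  data _⇝b_ : Bag → Sum Bag → Set where
    here  : ∀ {s S' ts} → s ⇝t S' → (s ∷ ts) ⇝b map (_∷ ts) S'
    there : ∀ {t ts TS'} → ts ⇝b TS' → (t ∷ ts) ⇝b map (t ∷_) TS'

_⇝_ : {σ : Sort} → Expr σ → Sum (Expr σ) → Set
_⇝_ {tm} = _⇝t_
_⇝_ {mn} = _⇝b_

data _⟶ₗ_ {σ : Sort} : Sum (Expr σ) → Sum (Expr σ) → Set where
  step : ∀ {e E' F} → e ⇝ E' → (e ∷ F) ⟶ₗ (E' ++ F)

-- The reduction on finite sums, taken on the quotient by ≈
-- (commutativity of +, multisets, α via de Bruijn).
_⟶_ : {σ : Sort} → Sum (Expr σ) → Sum (Expr σ) → Set
E ⟶ E' = ∃ λ F → ∃ λ F' → (E ≈ F) × (F ⟶ₗ F') × (F' ≈ E')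

module Submission where

-- We attach to every resource expression a natural number, its rank, and
-- show that a reduction step e + F →∂ E' + F replaces the rank of e by the
-- ranks of the summands of E', each of them smaller.  Up to ≈, the
-- multiset of ranks of a sum therefore performs a step of the multiset
-- ordering on ℕ, which is well founded; so no infinite reduction exists.
--
-- It then introduces
-- the profile of an expression (size, number of ⊕-nodes, ⊕-height): β
-- decreases the size, since linear substitution never duplicates, while
-- pulling a ⊕ out of a λ or an application keeps size and ⊕-count and
-- lowers the ⊕-height.  The rank size³ + ⊕-height turns this
-- lexicographic decrease into a decrease of natural numbers.

open import Defs
open import Data.Bool using (true; false)
open import Data.Nat using (ℕ; zero; suc; _+_; _*_; _≤_; _<_; z≤n; s≤s; _≟_; _<?_; _<ᵇ_; _≡ᵇ_)
open import Data.Nat.Properties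
open import Algebra.Properties.CommutativeSemigroup +-commutativeSemigroup using (x∙yz≈y∙xz; interchange)
open import Data.Nat.Induction using (<-wellFounded)
open import Data.Nat.Tactic.RingSolver using (solve-∀)
open import Data.List using (List; []; _∷_; _++_; length; filter; map; concatMap)
open import Data.List.Properties using (filter-++; filter-all; filter-none; filter-accept; filter-reject; map-++)
open import Data.List.Extrema.Nat using (max; xs≤max)
open import Data.List.Relation.Unary.All as All using (All; []; _∷_)
open import Data.List.Relation.Unary.All.Properties using (++⁺; all-filter; map⁺; concat⁺)
open import Data.List.Relation.Binary.Permutation.Propositional using (_↭_; prep; ↭-reflexive; ↭-trans) renaming (refl to ↭-refl; swap to ↭-swap)
open import Data.List.Relation.Binary.Permutation.Propositional.Properties using (All-resp-↭; filter-↭; ↭-length)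
open import Data.Product using (Σ; _×_; _,_; proj₁; proj₂)
open import Data.Sum using (_⊎_; inj₁; inj₂; [_,_])
open import Function using (flip; _∘_; case_of_)
open import Induction.InfiniteDescent using (InfiniteDescendingSequence)
open import Induction.WellFounded using (WellFounded; Acc; acc)
open import Relation.Nullary using (¬_; yes; no)
open import Relation.Binary.PropositionalEquality using (_≡_; refl; sym; cong; cong₂; subst; module ≡-Reasoning) renaming (trans to ≡-trans)

data _⟶ₘ_ (N N' : List ℕ) : Set where
  replace : ∀ {m rest smaller} → N ↭ m ∷ rest → All (_< m) smaller →
            smaller ++ rest ↭ N' → N ⟶ₘ N'

⟶ₘ-bounded : ∀ {B N N'} → N ⟶ₘ N' → All (_< B) N → All (_< B) N'
⟶ₘ-bounded (replace pick small result) bound with All-resp-↭ pick bound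
... | m<B ∷ rest<B = All-resp-↭ result (++⁺ (All.map (λ k<m → <-≤-trans k<m (<⇒≤ m<B)) small) rest<B)

occurrences : ℕ → List ℕ → ℕ
occurrences M N = length (filter (_≟ M) N)

below : ℕ → List ℕ → List ℕ
below M = filter (_<? M)

occurrences-↭ : ∀ {M N N'} → N ↭ N' → occurrences M N ≡ occurrences M N'
occurrences-↭ {M} p = ↭-length (filter-↭ (_≟ M) p)

occurrences-++ : ∀ {M K} G → All (_< M) K → occurrences M (K ++ G) ≡ occurrences M G
occurrences-++ {M} {K} G K<M = begin
  length (filter (_≟ M) (K ++ G))               ≡⟨ cong length (filter-++ (_≟ M) K G) ⟩
  length (filter (_≟ M) K ++ filter (_≟ M) G)   ≡⟨ cong (λ L → length (L ++ filter (_≟ M) G)) no-M-in-K ⟩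
  length (filter (_≟ M) G)                      ∎
  where
  open ≡-Reasoning
  no-M-in-K : filter (_≟ M) K ≡ []
  no-M-in-K = filter-none (_≟ M) (All.map (λ k<M k≡M → <-irrefl k≡M k<M) K<M)

below-++ : ∀ {M K} G → All (_< M) K → below M (K ++ G) ≡ K ++ below M G
below-++ {M} {K} G K<M = begin
  below M (K ++ G)          ≡⟨ filter-++ (_<? M) K G ⟩
  below M K ++ below M G    ≡⟨ cong (_++ below M G) (filter-all (_<? M) K<M) ⟩
  K ++ below M G            ∎
  where open ≡-Reasoning

⟶ₘ-split : ∀ {M N N'} → N ⟶ₘ N' → All (_< suc M) N →
  occurrences M N' < occurrences M N ⊎ (occurrences M N' ≡ occurrences M N × below M N ⟶ₘ below M N')
⟶ₘ-split {M} {N} {N'} (replace {m} {rest} {smaller} pick small result) bound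
  with All-resp-↭ pick bound
... | s≤s m≤M ∷ _ with m ≟ M
...   | yes refl = inj₁ (≤-reflexive (begin
        suc (occurrences M N')                 ≡⟨ cong suc (sym (occurrences-↭ result)) ⟩
        suc (occurrences M (smaller ++ rest))  ≡⟨ cong suc (occurrences-++ rest small) ⟩
        suc (occurrences M rest)               ≡⟨ cong length (sym (filter-accept (_≟ M) refl)) ⟩
        occurrences M (M ∷ rest)               ≡⟨ sym (occurrences-↭ pick) ⟩
        occurrences M N                        ∎))
  where open ≡-Reasoning
...   | no m≢M = inj₂ (same , replace pick' small result')
  where
  open ≡-Reasoning
  m<M = ≤∧≢⇒< m≤M m≢M
  small<M = All.map (λ k<m → <-≤-trans k<m (<⇒≤ m<M)) small
  same : occurrences M N' ≡ occurrences M N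
  same = begin
    occurrences M N'                  ≡⟨ sym (occurrences-↭ result) ⟩
    occurrences M (smaller ++ rest)   ≡⟨ occurrences-++ rest small<M ⟩
    occurrences M rest                ≡⟨ cong length (sym (filter-reject (_≟ M) m≢M)) ⟩
    occurrences M (m ∷ rest)          ≡⟨ sym (occurrences-↭ pick) ⟩
    occurrences M N                   ∎
  pick' : below M N ↭ m ∷ below M rest
  pick' = ↭-trans (filter-↭ (_<? M) pick) (↭-reflexive (filter-accept (_<? M) m<M))
  result' : smaller ++ below M rest ↭ below M N'
  result' = ↭-trans (↭-reflexive (sym (below-++ rest small<M))) (filter-↭ (_<? M) result)

-- Accessibility of a multiset bounded by M + 1, assuming that all multisets
-- bounded by M are accessible: by lexicographic induction on the number of
-- occurrences of M and on the accessibility of the part below M.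
module _ {M : ℕ} (accessible-below : ∀ {N} → All (_< M) N → Acc (flip _⟶ₘ_) N) where

  private
    below-accessible : ∀ N → Acc (flip _⟶ₘ_) (below M N)
    below-accessible N = accessible-below (all-filter (_<? M) N)

  descend : ∀ {c N} → Acc _<_ c → occurrences M N ≤ c → Acc (flip _⟶ₘ_) (below M N) →
            All (_< suc M) N → Acc (flip _⟶ₘ_) N
  descend count-acc@(acc smaller-count) N≤c (acc smaller-below) bound = acc λ {N'} step →
    [ (λ fewer → descend (smaller-count (<-≤-trans fewer N≤c)) ≤-refl
                   (below-accessible N') (⟶ₘ-bounded step bound))
    , (λ split → descend count-acc (≤-trans (≤-reflexive (proj₁ split)) N≤c)
                   (smaller-below (proj₂ split)) (⟶ₘ-bounded step bound))
    ] (⟶ₘ-split step bound)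

bounded-accessible : ∀ B {N} → All (_< B) N → Acc (flip _⟶ₘ_) N
bounded-accessible zero bound = acc λ { (replace pick _ _) → case All-resp-↭ pick bound of λ { (() ∷ _) } }
bounded-accessible (suc M) {N} bound =
  descend (bounded-accessible M) (<-wellFounded (occurrences M N)) ≤-refl
    (bounded-accessible M (all-filter (_<? M) N)) bound

-- The multiset ordering is well founded: every multiset is bounded by its maximum + 1.
⟶ₘ-wellFounded : WellFounded (flip _⟶ₘ_)
⟶ₘ-wellFounded N = bounded-accessible (suc (max 0 N)) (All.map s≤s (xs≤max 0 N))

acc⇒noDescent : ∀ {A : Set} {_<_ : A → A → Set} (f : ℕ → A) → Acc _<_ (f 0) → ¬ InfiniteDescendingSequence _<_ f
acc⇒noDescent f (acc smaller) descending = acc⇒noDescent (f ∘ suc) (smaller (descending 0)) (descending ∘ suc)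

-- The profile of a resource expression: its size, its number of ⊕-nodes,
-- and the ⊕-height, which counts every ⊕-node once for each λ or
-- application of which it lies in head position.
record Profile : Set where
  constructor profile⟨_,_,_⟩
  field
    size oplus height : ℕ
open Profile

infixl 6 _⊞_
_⊞_ : Profile → Profile → Profile
p ⊞ q = profile⟨ size p + size q , oplus p + oplus q , height p + height q ⟩

headNode : Profile → Profile
headNode p = profile⟨ suc (size p) , oplus p , height p + oplus p ⟩

oplusNode : Profile → Profile
oplusNode p = profile⟨ suc (size p) , suc (oplus p) , height p ⟩

mutual
  profile : Term → Profile
  profile (var _)   = profile⟨ 1 , 0 , 0 ⟩
  profile (lam s)   = headNode (profile s)
  profile (app s t) = headNode (profile s) ⊞ profileBag t
  profile (s ⊕•)    = oplusNode (profile s)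
  profile (•⊕ s)    = oplusNode (profile s)

  profileBag : Bag → Profile
  profileBag []       = profile⟨ 0 , 0 , 0 ⟩
  profileBag (t ∷ ts) = profile t ⊞ profileBag ts

profile-≡ : ∀ {a a' b b' c c'} → a ≡ a' → b ≡ b' → c ≡ c' →
            profile⟨ a , b , c ⟩ ≡ profile⟨ a' , b' , c' ⟩
profile-≡ refl refl refl = refl

⊞-assoc : ∀ p q r → (p ⊞ q) ⊞ r ≡ p ⊞ (q ⊞ r)
⊞-assoc p q r = profile-≡ (+-assoc (size p) (size q) (size r))
                          (+-assoc (oplus p) (oplus q) (oplus r))
                          (+-assoc (height p) (height q) (height r))

⊞-swap : ∀ p q r → p ⊞ (q ⊞ r) ≡ q ⊞ (p ⊞ r)
⊞-swap p q r = profile-≡ (x∙yz≈y∙xz (size p) (size q) (size r))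
                         (x∙yz≈y∙xz (oplus p) (oplus q) (oplus r))
                         (x∙yz≈y∙xz (height p) (height q) (height r))

mutual
  profile-≈ : ∀ {s s'} → s ≈t s' → profile s ≡ profile s'
  profile-≈ var≈       = refl
  profile-≈ (lam≈ p)   = cong headNode (profile-≈ p)
  profile-≈ (app≈ p q) = cong₂ (λ a b → headNode a ⊞ b) (profile-≈ p) (profileBag-≈ q)
  profile-≈ (l⊕≈ p)    = cong oplusNode (profile-≈ p)
  profile-≈ (r⊕≈ p)    = cong oplusNode (profile-≈ p)

  profileBag-≈ : ∀ {t t'} → PermR _≈t_ t t' → profileBag t ≡ profileBag t'
  profileBag-≈ nil                     = refl
  profileBag-≈ (cons p q)              = cong₂ _⊞_ (profile-≈ p) (profileBag-≈ q)
  profileBag-≈ (swap {x = x} {y} {xs}) = ⊞-swap (profile x) (profile y) (profileBag xs)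
  profileBag-≈ (trans p q)             = ≡-trans (profileBag-≈ p) (profileBag-≈ q)

mutual
  profile-shift : ∀ c s → profile (shift c s) ≡ profile s
  profile-shift c (var y) with y <ᵇ c
  ... | true  = refl
  ... | false = refl
  profile-shift c (lam s)   = cong headNode (profile-shift (suc c) s)
  profile-shift c (app s t) = cong₂ (λ a b → headNode a ⊞ b) (profile-shift c s) (profileBag-shift c t)
  profile-shift c (s ⊕•)    = cong oplusNode (profile-shift c s)
  profile-shift c (•⊕ s)    = cong oplusNode (profile-shift c s)

  profileBag-shift : ∀ c t → profileBag (shiftBag c t) ≡ profileBag t
  profileBag-shift c []       = refl
  profileBag-shift c (t ∷ ts) = cong₂ _⊞_ (profile-shift c t) (profileBag-shift c ts)

splits-⊞ : ∀ us → All (λ { (a , b) → profileBag a ⊞ profileBag b ≡ profileBag us }) (splits us)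
splits-⊞ []       = refl ∷ []
splits-⊞ (u ∷ us) = concat⁺ (map⁺ (All.map (λ { {a , b} e →
      ≡-trans (⊞-assoc (profile u) (profileBag a) (profileBag b)) (cong (profile u ⊞_) e)
    ∷ ≡-trans (⊞-swap (profileBag a) (profile u) (profileBag b)) (cong (profile u ⊞_) e)
    ∷ [] }) (splits-⊞ us)))

termSize : Term → ℕ
termSize s = size (profile s)

bagSize : Bag → ℕ
bagSize t = size (profileBag t)

All-concatMap : ∀ {A B : Set} {P : B → Set} {f : A → List B} xs →
                All (λ x → All P (f x)) xs → All P (concatMap f xs)
All-concatMap xs all = concat⁺ (map⁺ all)

split-bound : ∀ {a b c d U} S T → a ≤ S + c → b ≤ T + d → c + d ≡ U → a + b ≤ (S + T) + U
split-bound {a} {b} {c} {d} {U} S T a≤ b≤ c+d≡U = begin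
  a + b               ≤⟨ +-mono-≤ a≤ b≤ ⟩
  (S + c) + (T + d)   ≡⟨ interchange S c T d ⟩
  (S + T) + (c + d)   ≡⟨ cong ((S + T) +_) c+d≡U ⟩
  (S + T) + U         ∎
  where open ≤-Reasoning

mutual
  ∂-size : ∀ x s us → All (λ e → termSize e ≤ termSize s + bagSize us) (∂ x s us)
  ∂-size x (var y) [] with y ≡ᵇ x | y <ᵇ x
  ... | true  | _     = []
  ... | false | true  = ≤-refl ∷ []
  ... | false | false = ≤-refl ∷ []
  ∂-size x (var y) (u ∷ []) with y ≡ᵇ x
  ... | true  = m≤n⇒m≤1+n (m≤m+n (termSize u) 0) ∷ []
  ... | false = []
  ∂-size x (var y) (_ ∷ _ ∷ _) = []
  ∂-size x (lam s) us = map⁺ (All.map (λ e≤ → s≤s (subst (λ n → _ ≤ termSize s + n) shifted-size e≤))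
                                      (∂-size (suc x) s (shiftBag 0 us)))
    where shifted-size : bagSize (shiftBag 0 us) ≡ bagSize us
          shifted-size = cong size (profileBag-shift 0 us)
  ∂-size x (app s ts) us = All-concatMap (splits us) (All.map (λ { {u₁ , u₂} split →
      All-concatMap (∂ x s u₁) (All.map (λ s'≤ →
        map⁺ (All.map (λ t'≤ → s≤s (split-bound (termSize s) (bagSize ts) s'≤ t'≤ (cong size split)))
                      (∂Bag-size x ts u₂)))
        (∂-size x s u₁)) }) (splits-⊞ us))
  ∂-size x (s ⊕•) us = map⁺ (All.map s≤s (∂-size x s us))
  ∂-size x (•⊕ s) us = map⁺ (All.map s≤s (∂-size x s us))

  ∂Bag-size : ∀ x ts us → All (λ e → bagSize e ≤ bagSize ts + bagSize us) (∂Bag x ts us)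
  ∂Bag-size x [] []      = z≤n ∷ []
  ∂Bag-size x [] (_ ∷ _) = []
  ∂Bag-size x (t ∷ ts) us = All-concatMap (splits us) (All.map (λ { {u₁ , u₂} split →
      All-concatMap (∂ x t u₁) (All.map (λ t'≤ →
        map⁺ (All.map (λ ts'≤ → split-bound (termSize t) (bagSize ts) t'≤ ts'≤ (cong size split))
                      (∂Bag-size x ts u₂)))
        (∂-size x t u₁)) }) (splits-⊞ us))

infix 4 _≺_
_≺_ : Profile → Profile → Set
p ≺ q = size p < size q ⊎ (size p ≡ size q × oplus p ≡ oplus q × height p < height q)

≺-headNode : ∀ {p q} → p ≺ q → headNode p ≺ headNode q
≺-headNode (inj₁ smaller)                = inj₁ (s≤s smaller)
≺-headNode {q = q} (inj₂ (refl , refl , lower)) = inj₂ (refl , refl , +-monoˡ-< (oplus q) lower)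

≺-oplusNode : ∀ {p q} → p ≺ q → oplusNode p ≺ oplusNode q
≺-oplusNode (inj₁ smaller)               = inj₁ (s≤s smaller)
≺-oplusNode (inj₂ (refl , refl , lower)) = inj₂ (refl , refl , lower)

≺-⊞ˡ : ∀ {p q} r → p ≺ q → p ⊞ r ≺ q ⊞ r
≺-⊞ˡ r (inj₁ smaller)               = inj₁ (+-monoˡ-< (size r) smaller)
≺-⊞ˡ r (inj₂ (refl , refl , lower)) = inj₂ (refl , refl , +-monoˡ-< (height r) lower)

≺-⊞ʳ : ∀ {p q} r → p ≺ q → r ⊞ p ≺ r ⊞ q
≺-⊞ʳ r (inj₁ smaller)               = inj₁ (+-monoʳ-< (size r) smaller)
≺-⊞ʳ r (inj₂ (refl , refl , lower)) = inj₂ (refl , refl , +-monoʳ-< (height r) lower)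

⊕-out : ∀ p → oplusNode (headNode p) ≺ headNode (oplusNode p)
⊕-out p = inj₂ (refl , refl , +-monoʳ-< (height p) (n<1+n (oplus p)))

mutual
  reduct-≺ : ∀ {s S'} → s ⇝t S' → All (λ s' → profile s' ≺ profile s) S'
  reduct-≺ (β {s} {t})           = All.map (λ e≤ → inj₁ (s≤s (m≤n⇒m≤1+n e≤))) (∂-size 0 s t)
  reduct-≺ (app⊕• {s} {t})       = ≺-⊞ˡ (profileBag t) (⊕-out (profile s)) ∷ []
  reduct-≺ (app•⊕ {s} {t})       = ≺-⊞ˡ (profileBag t) (⊕-out (profile s)) ∷ []
  reduct-≺ (lam⊕• {s})           = ⊕-out (profile s) ∷ []
  reduct-≺ (lam•⊕ {s})           = ⊕-out (profile s) ∷ []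
  reduct-≺ (ctx-lam r)           = map⁺ (All.map ≺-headNode (reduct-≺ r))
  reduct-≺ (ctx-appˡ {t = t} r)  = map⁺ (All.map (≺-⊞ˡ (profileBag t) ∘ ≺-headNode) (reduct-≺ r))
  reduct-≺ (ctx-⊕• r)            = map⁺ (All.map ≺-oplusNode (reduct-≺ r))
  reduct-≺ (ctx-•⊕ r)            = map⁺ (All.map ≺-oplusNode (reduct-≺ r))
  reduct-≺ (ctx-appʳ {s = s} r)  = map⁺ (All.map (≺-⊞ʳ (headNode (profile s))) (reductBag-≺ r))

  reductBag-≺ : ∀ {t T'} → t ⇝b T' → All (λ t' → profileBag t' ≺ profileBag t) T'
  reductBag-≺ (here {ts = ts} r) = map⁺ (All.map (≺-⊞ˡ (profileBag ts)) (reduct-≺ r))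
  reductBag-≺ (there {t = t} r)  = map⁺ (All.map (≺-⊞ʳ (profile t)) (reductBag-≺ r))

Balanced : Profile → Set
Balanced p = oplus p ≤ size p × height p ≤ size p * size p

square-suc : ∀ n → n * n + n ≤ suc n * suc n
square-suc n = begin
  n * n + n               ≤⟨ m≤m+n (n * n + n) (suc n) ⟩
  n * n + n + suc n       ≡⟨ expand n ⟩
  suc n * suc n           ∎
  where
  open ≤-Reasoning
  expand : ∀ n → n * n + n + suc n ≡ suc n * suc n
  expand = solve-∀

square-+ : ∀ m n → m * m + n * n ≤ (m + n) * (m + n)
square-+ m n = begin
  m * m + n * n                   ≤⟨ m≤m+n (m * m + n * n) (2 * (m * n)) ⟩
  m * m + n * n + 2 * (m * n)     ≡⟨ expand m n ⟩
  (m + n) * (m + n)               ∎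
  where
  open ≤-Reasoning
  expand : ∀ m n → m * m + n * n + 2 * (m * n) ≡ (m + n) * (m + n)
  expand = solve-∀

balanced-headNode : ∀ {p} → Balanced p → Balanced (headNode p)
balanced-headNode {p} (o≤s , h≤s²) =
  m≤n⇒m≤1+n o≤s , ≤-trans (+-mono-≤ h≤s² o≤s) (square-suc (size p))

balanced-oplusNode : ∀ {p} → Balanced p → Balanced (oplusNode p)
balanced-oplusNode {p} (o≤s , h≤s²) =
  s≤s o≤s , ≤-trans h≤s² (*-mono-≤ (n≤1+n (size p)) (n≤1+n (size p)))

balanced-⊞ : ∀ {p q} → Balanced p → Balanced q → Balanced (p ⊞ q)
balanced-⊞ {p} {q} (op≤sp , hp≤sp²) (oq≤sq , hq≤sq²) =
  +-mono-≤ op≤sp oq≤sq , ≤-trans (+-mono-≤ hp≤sp² hq≤sq²) (square-+ (size p) (size q))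

mutual
  profile-balanced : ∀ s → Balanced (profile s)
  profile-balanced (var _)   = z≤n , z≤n
  profile-balanced (lam s)   = balanced-headNode (profile-balanced s)
  profile-balanced (app s t) = balanced-⊞ (balanced-headNode (profile-balanced s)) (profileBag-balanced t)
  profile-balanced (s ⊕•)    = balanced-oplusNode (profile-balanced s)
  profile-balanced (•⊕ s)    = balanced-oplusNode (profile-balanced s)

  profileBag-balanced : ∀ t → Balanced (profileBag t)
  profileBag-balanced []       = z≤n , z≤n
  profileBag-balanced (t ∷ ts) = balanced-⊞ (profile-balanced t) (profileBag-balanced ts)

-- The rank of a profile, a natural number that decreases along ≺ from
-- balanced profiles: a cube of the size dominates any admissible height.
rank : Profile → ℕ
rank p = size p * size p * size p + height p

cube-step : ∀ {m n} h → m < n → m * m * m + m * m < n * n * n + h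
cube-step {m} {n} h m<n = begin-strict
  m * m * m + m * m                               <⟨ s≤s (m≤m+n _ (m * m * 2 + m * 3)) ⟩
  suc (m * m * m + m * m) + (m * m * 2 + m * 3)   ≡⟨ expand m ⟩
  suc m * suc m * suc m                           ≤⟨ *-mono-≤ (*-mono-≤ m<n m<n) m<n ⟩
  n * n * n                                       ≤⟨ m≤m+n (n * n * n) h ⟩
  n * n * n + h                                   ∎
  where
  open ≤-Reasoning
  expand : ∀ m → suc (m * m * m + m * m) + (m * m * 2 + m * 3) ≡ suc m * suc m * suc m
  expand = solve-∀

≺-rank : ∀ {p q} → p ≺ q → Balanced p → rank p < rank q
≺-rank {p} {q} (inj₁ smaller) (_ , h≤s²) =
  ≤-<-trans (+-monoʳ-≤ (size p * size p * size p) h≤s²) (cube-step (height q) smaller)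
≺-rank {p} (inj₂ (refl , _ , lower)) _ = +-monoʳ-< (size p * size p * size p) lower

profileOf : (σ : Sort) → Expr σ → Profile
profileOf tm = profile
profileOf mn = profileBag

exprRank : (σ : Sort) → Expr σ → ℕ
exprRank σ e = rank (profileOf σ e)

exprRank-≈ : ∀ σ {e e'} → _≈E_ {σ} e e' → exprRank σ e ≡ exprRank σ e'
exprRank-≈ tm e≈e' = cong rank (profile-≈ e≈e')
exprRank-≈ mn e≈e' = cong rank (profileBag-≈ e≈e')

reduct-rank : ∀ σ {e E'} → _⇝_ {σ} e E' → All (λ e' → exprRank σ e' < exprRank σ e) E'
reduct-rank tm r = All.map (λ {s'} lt → ≺-rank lt (profile-balanced s')) (reduct-≺ r)
reduct-rank mn r = All.map (λ {t'} lt → ≺-rank lt (profileBag-balanced t')) (reductBag-≺ r)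

map-PermR : ∀ {A B : Set} {R : A → A → Set} (f : A → B) → (∀ {x y} → R x y → f x ≡ f y) →
            ∀ {xs ys} → PermR R xs ys → map f xs ↭ map f ys
map-PermR f f-resp nil         = ↭-refl
map-PermR f f-resp (cons {x = x} {xs = xs} {ys = ys} x~y xs~ys) =
  subst (λ z → f x ∷ map f xs ↭ z ∷ map f ys) (f-resp x~y) (prep (f x) (map-PermR f f-resp xs~ys))
map-PermR f f-resp swap        = ↭-swap _ _ ↭-refl
map-PermR f f-resp (trans p q) = ↭-trans (map-PermR f f-resp p) (map-PermR f f-resp q)

rank-step : ∀ σ {E E' : Sum (Expr σ)} → E ⟶ E' → map (exprRank σ) E ⟶ₘ map (exprRank σ) E'
rank-step σ (_ , _ , E≈F , step {E' = E'} {F = G} r , F'≈E'') =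
  replace (map-PermR (exprRank σ) (exprRank-≈ σ) E≈F)
          (map⁺ (reduct-rank σ r))
          (↭-trans (↭-reflexive (sym (map-++ (exprRank σ) E' G)))
                   (map-PermR (exprRank σ) (exprRank-≈ σ) F'≈E''))

lemma4p1 : (σ : Sort) → ¬ (Σ (ℕ → Sum (Expr σ)) λ E → (n : ℕ) → E n ⟶ E (suc n))
lemma4p1 σ (E , reduces) =
  acc⇒noDescent (map (exprRank σ) ∘ E) (⟶ₘ-wellFounded _) (λ n → rank-step σ (reduces n))
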